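{- Let $\mathcal M(2)=(\mathcal P,\mathcal Z)$ be a Möbius plane of order $2$ and let $S$ be a split-resolving set of minimum cardinality of its point-circle incidence graph. Then $|S\cap\mathcal P|=4$ and $|S\cap\mathcal Z|=3$.
   Context: A Möbius plane is a pair $(\mathcal P,\mathcal Z)$, where $\mathcal P$ is a set (of points) and $\mathcal Z$ is a set of subsets of $\mathcal P$ (circles), such that: (i) any three pairwise distinct points lie on exactly one circle; (ii) if $z\in\mathcal Z$, $P\in z$ and $Q\in\mathcal P\setminus z$, there is exactly one circle $z'$ through $P$ and $Q$ with $z\cap z'=\{P\}$; (iii) there is at least one circle and every circle has at least three points; (iv) for every circle $z$ there is a point not on $z$. A finite Möbius plane has order $q$ if every circle has $q+1$ points. The point-circle incidence graph has vertex set $\mathcal P\cup\mathcal Z$ and edges $\{P,z\}$ with $P\in z$, with shortest-path distance $d$. A set $S$ resolves $W$ if for any two distinct $u,v\in W$ there is $s\in S$ with $d(u,s)\ne d(v,s)$. A set $S\subseteq\mathcal P\cup\mathcal Z$ is split-resolving if $S\cap\mathcal P$ resolves $\mathcal Z$ and $S\cap\mathcal Z$ resolves $\mathcal P$. -}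

module Defs where

open import Data.Nat using (ℕ; zero; suc; _<_)
open import Data.Fin using (Fin)
open import Data.Fin.Subset using (Subset; _∈_; _∉_; ∣_∣)
open import Data.Sum using (_⊎_; inj₁; inj₂)
open import Data.Product using (Σ; ∃; _×_; _,_)
open import Relation.Binary.PropositionalEquality using (_≡_; _≢_)
open import Relation.Nullary using (¬_)

record MobiusPlane (n m : ℕ) : Set where
  field
    circle : Fin m → Subset n
    circle-inj : ∀ z z' → circle z ≡ circle z' → z ≡ z'
    three-exist : ∀ (a b c : Fin n) → a ≢ b → a ≢ c → b ≢ c →
      Σ (Fin m) λ z → a ∈ circle z × b ∈ circle z × c ∈ circle z
    three-unique : ∀ (a b c : Fin n) → a ≢ b → a ≢ c → b ≢ c → ∀ z z' →
      a ∈ circle z → b ∈ circle z → c ∈ circle z →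
      a ∈ circle z' → b ∈ circle z' → c ∈ circle z' → z ≡ z'
    touch-exist : ∀ (z : Fin m) (P Q : Fin n) → P ∈ circle z → Q ∉ circle z →
      Σ (Fin m) λ z' → P ∈ circle z' × Q ∈ circle z' ×
        (∀ R → R ∈ circle z → R ∈ circle z' → R ≡ P)
    touch-unique : ∀ (z : Fin m) (P Q : Fin n) → P ∈ circle z → Q ∉ circle z →
      ∀ z₁ z₂ →
      P ∈ circle z₁ → Q ∈ circle z₁ → (∀ R → R ∈ circle z → R ∈ circle z₁ → R ≡ P) →
      P ∈ circle z₂ → Q ∈ circle z₂ → (∀ R → R ∈ circle z → R ∈ circle z₂ → R ≡ P) →
      z₁ ≡ z₂
    some-circle : Fin m
    circle-size : ∀ z → 3 Data.Nat.≤ ∣ circle z ∣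
    circle-miss : ∀ z → Σ (Fin n) λ P → P ∉ circle z

open MobiusPlane public

HasOrder : ∀ {n m} → MobiusPlane n m → ℕ → Set
HasOrder M q = ∀ z → ∣ circle M z ∣ ≡ suc q

module _ {n m : ℕ} (M : MobiusPlane n m) where

  Vertex : Set
  Vertex = Fin n ⊎ Fin m

  data Adj : Vertex → Vertex → Set where
    pz : ∀ {P z} → P ∈ circle M z → Adj (inj₁ P) (inj₂ z)
    zp : ∀ {P z} → P ∈ circle M z → Adj (inj₂ z) (inj₁ P)

  data Walk : Vertex → Vertex → ℕ → Set where
    here : ∀ {u} → Walk u u zero
    step : ∀ {u v w k} → Adj u v → Walk v w k → Walk u w (suc k)

  IsDist : Vertex → Vertex → ℕ → Set
  IsDist u v k = Walk u v k × (∀ j → j < k → ¬ Walk u v j)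

  Distinguishes : Vertex → Vertex → Vertex → Set
  Distinguishes s u v = Σ ℕ λ k → Σ ℕ λ k' → IsDist u s k × IsDist v s k' × k ≢ k'

  SplitResolving : Subset n → Subset m → Set
  SplitResolving SP SZ =
    (∀ (z z' : Fin m) → z ≢ z' →
       Σ (Fin n) λ P → P ∈ SP × Distinguishes (inj₁ P) (inj₂ z) (inj₂ z')) ×
    (∀ (P P' : Fin n) → P ≢ P' →
       Σ (Fin m) λ z → z ∈ SZ × Distinguishes (inj₂ z) (inj₁ P) (inj₁ P'))

  -- |S| = |S ∩ P| + |S ∩ Z|, minimal among split-resolving sets
  MinSplitResolving : Subset n → Subset m → Set
  MinSplitResolving SP SZ = SplitResolving SP SZ ×
    (∀ SP' SZ' → SplitResolving SP' SZ' → ∣ SP ∣ Data.Nat.+ ∣ SZ ∣ Data.Nat.≤ ∣ SP' ∣ Data.Nat.+ ∣ SZ' ∣)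

-- In the point-circle incidence graph a point and a circle are at distance 1 if
-- incident and 3 otherwise (the touching circle through the point and some point of
-- the given circle closes a path of length 3), so a split-resolving set is a set of
-- points separating the circles by incidence together with a set of circles
-- separating the points.  In order 2 a circle z₀ and the circle z₁ touching it at A
-- through a point D off z₀ cover all points (the circle through A, D and any further
-- point off z₀ also touches z₀ at A, so it is z₁), hence there are 3 + 3 − 1 = 5
-- points and every 3-subset is a circle.  Four points separate circles, since two
-- 3-sets that agree on four of five points are equal, but three do not: with a, b
-- unchosen and s, t two other points, the circles {s,t,a} and {s,t,b} agree on every
-- chosen point.  The circles {0,1,2}, {0,1,3}, {0,2,3} separate the points, but two
-- circles cannot, as they give only four incidence patterns for five points.

module Submission where

open import Defs
open import Data.Nat using (ℕ)
open import Data.Fin.Subset using (Subset; ∣_∣)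
open import Data.Product using (_×_)
open import Relation.Binary.PropositionalEquality using (_≡_)

open import Data.Bool using (Bool; true; false; _∨_)
open import Data.Bool.Properties using () renaming (_≟_ to _≟ᵇ_)
open import Data.Empty using (⊥-elim)
open import Data.Fin using (Fin; zero; suc; combine; #_)
open import Data.Fin.Properties
  using (_≟_; suc-injective; combine-injective; injective⇒≤; any?; all?; 2↔Bool)
open import Data.Fin.Subset using (_∈_; _∉_; ⁅_⁆; _∪_; _∩_; _-_; ∁; ⊤; Nonempty)
open import Data.Fin.Subset.Properties
  using (_∈?_; nonempty?; drop-there; x∈⁅x⁆; x∈⁅y⁆⇒x≡y; x≢y⇒x∉⁅y⁆; ∣⁅x⁆∣≡1; ∣⊤∣≡n;
         x∈p∪q⁺; x∈p∪q⁻; ∈⊤; x∈p∩q⁺; x∈p∩q⁻; ⊆-antisym; x∉p⇒x∈∁p;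
         x∈p⇒∣p-x∣<∣p∣; x∈p∧x≢y⇒x∈p-y)
open import Data.Nat using (zero; suc; _+_; _≤_; _<_; z≤n; s≤s; _≤?_)
open import Data.Nat.Properties
  using (+-suc; m≤n+m; ≤-trans; ≤-<-trans; ≤-reflexive; <⇒≱; ≰⇒>; <-cmp; +-mono-≤;
         +-monoʳ-≤; +-monoˡ-≤; +-cancelʳ-≤; +-cancelˡ-≤; ≤-antisym; 1+n≢n)
import Data.Nat.Properties as ℕ
open import Data.Product using (∃; ∃₂; _,_)
import Data.Product as Product
import Data.Sum as Sum
open import Data.Sum using (_⊎_; inj₁; inj₂; [_,_])
open import Data.Vec using ([]; _∷_; lookup; here; there)
open import Data.Vec.Properties
  using (lookup-zipWith; lookup-replicate; []=⇒lookup; lookup⇒[]=; tabulate∘lookup; tabulate-cong)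
open import Function using (_∘_; Inverse)
open import Function.Bundles using (_⇔_; mk⇔; Equivalence)
open import Function.Properties.Equivalence using () renaming (trans to ⇔-trans)
open import Relation.Binary.Definitions using (tri<; tri≈; tri>)
open import Relation.Binary.PropositionalEquality
  using (_≢_; refl; sym; trans; cong; cong₂; subst; ≢-sym; module ≡-Reasoning)
open import Relation.Nullary using (¬_; Dec; yes; no; does; contradiction; ¬?)
open import Relation.Nullary.Decidable
  using (dec-false; decidable-stable; from-yes; _⊎-dec_; _×-dec_)

private variable
  k : ℕ
  p q : Subset k
  a b c c' x y : Fin k

∣p∩q∣+∣p∪q∣≡∣p∣+∣q∣ : (p q : Subset k) → ∣ p ∩ q ∣ + ∣ p ∪ q ∣ ≡ ∣ p ∣ + ∣ q ∣
∣p∩q∣+∣p∪q∣≡∣p∣+∣q∣ [] [] = refl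
∣p∩q∣+∣p∪q∣≡∣p∣+∣q∣ (true ∷ p) (true ∷ q) =
  cong suc (trans (+-suc _ _) (trans (cong suc (∣p∩q∣+∣p∪q∣≡∣p∣+∣q∣ p q)) (sym (+-suc _ _))))
∣p∩q∣+∣p∪q∣≡∣p∣+∣q∣ (true ∷ p) (false ∷ q) = trans (+-suc _ _) (cong suc (∣p∩q∣+∣p∪q∣≡∣p∣+∣q∣ p q))
∣p∩q∣+∣p∪q∣≡∣p∣+∣q∣ (false ∷ p) (true ∷ q) =
  trans (+-suc _ _) (trans (cong suc (∣p∩q∣+∣p∪q∣≡∣p∣+∣q∣ p q)) (sym (+-suc _ _)))
∣p∩q∣+∣p∪q∣≡∣p∣+∣q∣ (false ∷ p) (false ∷ q) = ∣p∩q∣+∣p∪q∣≡∣p∣+∣q∣ p q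

∣p∪q∣≤∣p∣+∣q∣ : (p q : Subset k) → ∣ p ∪ q ∣ ≤ ∣ p ∣ + ∣ q ∣
∣p∪q∣≤∣p∣+∣q∣ p q = subst (∣ p ∪ q ∣ ≤_) (∣p∩q∣+∣p∪q∣≡∣p∣+∣q∣ p q) (m≤n+m _ _)

∣p∣>0⇒Nonempty : (p : Subset k) → 0 < ∣ p ∣ → Nonempty p
∣p∣>0⇒Nonempty (true ∷ p) _ = zero , here
∣p∣>0⇒Nonempty (false ∷ p) ∣p∣>0 = Product.map suc there (∣p∣>0⇒Nonempty p ∣p∣>0)

∃-∉ : (p : Subset k) → ∣ p ∣ < k → ∃ λ x → x ∉ p
∃-∉ (false ∷ p) _ = zero , λ ()
∃-∉ (true ∷ p) (s≤s ∣p∣<k) = Product.map suc (_∘ drop-there) (∃-∉ p ∣p∣<k)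

∃₂-∉ : (p : Subset k) → 2 + ∣ p ∣ ≤ k → ∃₂ λ x y → x ≢ y × x ∉ p × y ∉ p
∃₂-∉ (false ∷ p) (s≤s ∣p∣<k) with y , y∉p ← ∃-∉ p ∣p∣<k =
  zero , suc y , (λ ()) , (λ ()) , y∉p ∘ drop-there
∃₂-∉ (true ∷ p) (s≤s 2+∣p∣≤k) with x , y , x≢y , x∉p , y∉p ← ∃₂-∉ p 2+∣p∣≤k =
  suc x , suc y , x≢y ∘ suc-injective , x∉p ∘ drop-there , y∉p ∘ drop-there

≤∣p-x∣⇒<∣p∣ : ∀ {j} → x ∈ p → j ≤ ∣ p - x ∣ → j < ∣ p ∣
≤∣p-x∣⇒<∣p∣ x∈p j≤∣p-x∣ = ≤-<-trans j≤∣p-x∣ (x∈p⇒∣p-x∣<∣p∣ x∈p)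

triple : Fin k → Fin k → Fin k → Subset k
triple a b c = ⁅ a ⁆ ∪ ⁅ b ⁆ ∪ ⁅ c ⁆

∈-triple⇔ : x ∈ triple a b c ⇔ (x ≡ a ⊎ x ≡ b ⊎ x ≡ c)
∈-triple⇔ {a = a} {b = b} {c = c} = mk⇔ to from
  where
  to : ∀ {x} → x ∈ triple a b c → x ≡ a ⊎ x ≡ b ⊎ x ≡ c
  to x∈ with x∈p∪q⁻ ⁅ a ⁆ _ x∈
  ... | inj₁ x∈a = inj₁ (x∈⁅y⁆⇒x≡y a x∈a)
  ... | inj₂ x∈bc = inj₂ (Sum.map (x∈⁅y⁆⇒x≡y b) (x∈⁅y⁆⇒x≡y c) (x∈p∪q⁻ ⁅ b ⁆ _ x∈bc))
  from : ∀ {x} → x ≡ a ⊎ x ≡ b ⊎ x ≡ c → x ∈ triple a b c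
  from (inj₁ refl) = x∈p∪q⁺ (inj₁ (x∈⁅x⁆ a))
  from (inj₂ (inj₁ refl)) = x∈p∪q⁺ (inj₂ (x∈p∪q⁺ (inj₁ (x∈⁅x⁆ b))))
  from (inj₂ (inj₂ refl)) = x∈p∪q⁺ {p = ⁅ a ⁆} (inj₂ (x∈p∪q⁺ {p = ⁅ b ⁆} (inj₂ (x∈⁅x⁆ c))))

∣triple∣≤3 : (a b c : Fin k) → ∣ triple a b c ∣ ≤ 3
∣triple∣≤3 a b c = ≤-trans (∣p∪q∣≤∣p∣+∣q∣ ⁅ a ⁆ _)
  (+-mono-≤ (≤-reflexive (∣⁅x⁆∣≡1 a))
    (≤-trans (∣p∪q∣≤∣p∣+∣q∣ ⁅ b ⁆ _)
      (+-mono-≤ (≤-reflexive (∣⁅x⁆∣≡1 b)) (≤-reflexive (∣⁅x⁆∣≡1 c)))))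

lookup-⁅⁆ : (x y : Fin k) → lookup ⁅ y ⁆ x ≡ does (x ≟ y)
lookup-⁅⁆ zero zero = refl
lookup-⁅⁆ zero (suc y) = refl
lookup-⁅⁆ (suc x) zero = lookup-replicate x false
lookup-⁅⁆ (suc x) (suc y) = lookup-⁅⁆ x y

lookup-triple : (x : Fin k) → lookup (triple a b c) x ≡ does (x ≟ a) ∨ does (x ≟ b) ∨ does (x ≟ c)
lookup-triple {a = a} {b = b} {c = c} x = begin
  lookup (triple a b c) x
    ≡⟨ lookup-zipWith _∨_ x ⁅ a ⁆ _ ⟩
  lookup ⁅ a ⁆ x ∨ lookup (⁅ b ⁆ ∪ ⁅ c ⁆) x
    ≡⟨ cong (lookup ⁅ a ⁆ x ∨_) (lookup-zipWith _∨_ x ⁅ b ⁆ _) ⟩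
  lookup ⁅ a ⁆ x ∨ lookup ⁅ b ⁆ x ∨ lookup ⁅ c ⁆ x
    ≡⟨ cong₂ _∨_ (lookup-⁅⁆ x a) (cong₂ _∨_ (lookup-⁅⁆ x b) (lookup-⁅⁆ x c)) ⟩
  does (x ≟ a) ∨ does (x ≟ b) ∨ does (x ≟ c)
    ∎
  where open ≡-Reasoning

lookup-triple-swap : (a b x : Fin k) → x ≢ c → x ≢ c' →
                     lookup (triple a b c) x ≡ lookup (triple a b c') x
lookup-triple-swap {c = c} {c' = c'} a b x x≢c x≢c' = begin
  lookup (triple a b c) x                      ≡⟨ lookup-triple x ⟩
  does (x ≟ a) ∨ does (x ≟ b) ∨ does (x ≟ c)   ≡⟨ cong (λ d → does (x ≟ a) ∨ does (x ≟ b) ∨ d) d≡d' ⟩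
  does (x ≟ a) ∨ does (x ≟ b) ∨ does (x ≟ c')  ≡⟨ lookup-triple x ⟨
  lookup (triple a b c') x                     ∎
  where
  open ≡-Reasoning
  d≡d' : does (x ≟ c) ≡ does (x ≟ c')
  d≡d' = trans (dec-false (x ≟ c) x≢c) (sym (dec-false (x ≟ c') x≢c'))

triple-≢ : c ≢ a → c ≢ b → c ≢ c' → triple a b c ≢ triple a b c'
triple-≢ c≢a c≢b c≢c' eq = [ c≢a , [ c≢b , c≢c' ] ] (Equivalence.to ∈-triple⇔ c∈abc')
  where
  c∈abc' = subst (_ ∈_) eq (Equivalence.from ∈-triple⇔ (inj₂ (inj₂ refl)))

∉⁅a⁆∪⁅b⁆⇒≢ : x ∉ ⁅ a ⁆ ∪ ⁅ b ⁆ → x ≢ a × x ≢ b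
∉⁅a⁆∪⁅b⁆⇒≢ x∉ = (λ { refl → x∉ (x∈p∪q⁺ (inj₁ (x∈⁅x⁆ _))) }) ,
                 (λ { refl → x∉ (x∈p∪q⁺ (inj₂ (x∈⁅x⁆ _))) })

∣⁅a⁆∪⁅b⁆∣≤2 : (a b : Fin k) → ∣ ⁅ a ⁆ ∪ ⁅ b ⁆ ∣ ≤ 2
∣⁅a⁆∪⁅b⁆∣≤2 a b =
  ≤-trans (∣p∪q∣≤∣p∣+∣q∣ ⁅ a ⁆ ⁅ b ⁆) (≤-reflexive (cong₂ _+_ (∣⁅x⁆∣≡1 a) (∣⁅x⁆∣≡1 b)))

∣p∣≤2⇒∈-pair : ∣ p ∣ ≤ 2 → a ∈ p → b ∈ p → a ≢ b → x ∈ p → x ≡ a ⊎ x ≡ b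
∣p∣≤2⇒∈-pair {p = p} {a = a} {b = b} {x = x} ∣p∣≤2 a∈p b∈p a≢b x∈p with x ≟ a | x ≟ b
... | yes x≡a | _ = inj₁ x≡a
... | no _ | yes x≡b = inj₂ x≡b
... | no x≢a | no x≢b = contradiction ∣p∣≤2 (<⇒≱ 2<∣p∣)
  where
  2<∣p∣ : 2 < ∣ p ∣
  2<∣p∣ = ≤∣p-x∣⇒<∣p∣ a∈p (≤∣p-x∣⇒<∣p∣ (x∈p∧x≢y⇒x∈p-y b∈p (≢-sym a≢b))
    (≤∣p-x∣⇒<∣p∣ (x∈p∧x≢y⇒x∈p-y (x∈p∧x≢y⇒x∈p-y x∈p x≢a) x≢b) z≤n))

∣p∣≤3⇒∈-triple : ∣ p ∣ ≤ 3 → a ∈ p → b ∈ p → c ∈ p → a ≢ b → a ≢ c → b ≢ c →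
                 x ∈ p → x ≡ a ⊎ x ≡ b ⊎ x ≡ c
∣p∣≤3⇒∈-triple {p = p} {a = a} {b = b} {c = c} {x = x} ∣p∣≤3 a∈p b∈p c∈p a≢b a≢c b≢c x∈p
  with x ≟ a | x ≟ b | x ≟ c
... | yes x≡a | _ | _ = inj₁ x≡a
... | no _ | yes x≡b | _ = inj₂ (inj₁ x≡b)
... | no _ | no _ | yes x≡c = inj₂ (inj₂ x≡c)
... | no x≢a | no x≢b | no x≢c = contradiction ∣p∣≤3 (<⇒≱ 3<∣p∣)
  where
  3<∣p∣ : 3 < ∣ p ∣
  3<∣p∣ = ≤∣p-x∣⇒<∣p∣ a∈p (≤∣p-x∣⇒<∣p∣ (x∈p∧x≢y⇒x∈p-y b∈p (≢-sym a≢b))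
    (≤∣p-x∣⇒<∣p∣ (x∈p∧x≢y⇒x∈p-y (x∈p∧x≢y⇒x∈p-y c∈p (≢-sym a≢c)) (≢-sym b≢c))
      (≤∣p-x∣⇒<∣p∣ (x∈p∧x≢y⇒x∈p-y (x∈p∧x≢y⇒x∈p-y (x∈p∧x≢y⇒x∈p-y x∈p x≢a) x≢b) x≢c) z≤n)))

∣p∣≤2⇒∃-cover : (d : Fin k) (p : Subset k) → ∣ p ∣ ≤ 2 →
                ∃₂ λ a b → ∀ {x} → x ∈ p → x ≡ a ⊎ x ≡ b
∣p∣≤2⇒∃-cover d p ∣p∣≤2 with nonempty? p
... | no p-empty = d , d , λ x∈p → contradiction (_ , x∈p) p-empty
... | yes (a , a∈p) with any? (λ b → b ∈? p ×-dec ¬? (b ≟ a))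
...   | yes (b , b∈p , b≢a) = a , b , ∣p∣≤2⇒∈-pair ∣p∣≤2 a∈p b∈p (≢-sym b≢a)
...   | no no-other =
  a , a , λ {x} x∈p → inj₁ (decidable-stable (x ≟ a) (λ x≢a → no-other (x , x∈p , x≢a)))

≗-lookup⇒≡ : (p q : Subset k) → (∀ y → lookup p y ≡ lookup q y) → p ≡ q
≗-lookup⇒≡ p q agree =
  trans (sym (tabulate∘lookup p)) (trans (tabulate-cong agree) (tabulate∘lookup q))

∣b∷p∣≡∣c∷p∣⇒b≡c : ∀ (b c : Bool) (p : Subset k) → ∣ b ∷ p ∣ ≡ ∣ c ∷ p ∣ → b ≡ c
∣b∷p∣≡∣c∷p∣⇒b≡c false false p _ = refl
∣b∷p∣≡∣c∷p∣⇒b≡c false true p ∣p∣≡1+∣p∣ = contradiction (sym ∣p∣≡1+∣p∣) 1+n≢n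
∣b∷p∣≡∣c∷p∣⇒b≡c true false p 1+∣p∣≡∣p∣ = contradiction 1+∣p∣≡∣p∣ 1+n≢n
∣b∷p∣≡∣c∷p∣⇒b≡c true true p _ = refl

∣b∷p∣≡∣b∷q∣⇒∣p∣≡∣q∣ : ∀ (b : Bool) (p q : Subset k) → ∣ b ∷ p ∣ ≡ ∣ b ∷ q ∣ → ∣ p ∣ ≡ ∣ q ∣
∣b∷p∣≡∣b∷q∣⇒∣p∣≡∣q∣ false p q ∣p∣≡∣q∣ = ∣p∣≡∣q∣
∣b∷p∣≡∣b∷q∣⇒∣p∣≡∣q∣ true p q 1+∣p∣≡1+∣q∣ = ℕ.suc-injective 1+∣p∣≡1+∣q∣

agree-except⇒≡ : (p q : Subset k) (x : Fin k) → ∣ p ∣ ≡ ∣ q ∣ →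
                 (∀ y → y ≢ x → lookup p y ≡ lookup q y) → p ≡ q
agree-except⇒≡ (b ∷ p) (c ∷ q) zero ∣b∷p∣≡∣c∷q∣ agree
  with refl ← ≗-lookup⇒≡ p q (λ y → agree (suc y) (λ ())) =
  cong (_∷ p) (∣b∷p∣≡∣c∷p∣⇒b≡c b c p ∣b∷p∣≡∣c∷q∣)
agree-except⇒≡ (b ∷ p) (c ∷ q) (suc x) ∣b∷p∣≡∣c∷q∣ agree
  with refl ← agree zero (λ ()) =
  cong (b ∷_) (agree-except⇒≡ p q x (∣b∷p∣≡∣b∷q∣⇒∣p∣≡∣q∣ b p q ∣b∷p∣≡∣c∷q∣)
                 (λ y y≢x → agree (suc y) (y≢x ∘ suc-injective)))

Separates : Subset k → Fin k → Fin k → Set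
Separates p x y = lookup p x ≢ lookup p y

separated-by-two⇒≤4 : (q₁ q₂ : Subset k) →
                      (∀ x y → x ≢ y → Separates q₁ x y ⊎ Separates q₂ x y) → k ≤ 4
separated-by-two⇒≤4 {k} q₁ q₂ separated = injective⇒≤ {f = signature} signature-injective
  where
  open Inverse 2↔Bool using (to; from; inverseˡ)
  from-injective : ∀ {b b'} → from b ≡ from b' → b ≡ b'
  from-injective e = trans (sym (inverseˡ refl)) (trans (cong to e) (inverseˡ refl))
  signature : Fin k → Fin 4
  signature x = combine (from (lookup q₁ x)) (from (lookup q₂ x))
  signature-injective : ∀ {x y} → signature x ≡ signature y → x ≡ y
  signature-injective {x} {y} same with x ≟ y
  ... | yes x≡y = x≡y
  ... | no x≢y with e₁ , e₂ ← combine-injective _ _ _ _ same =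
    ⊥-elim ([ (λ ne → ne (from-injective e₁)) , (λ ne → ne (from-injective e₂)) ]
              (separated x y x≢y))

separates? : (p : Subset k) (x y : Fin k) → Dec (Separates p x y)
separates? p x y = ¬? (lookup p x ≟ᵇ lookup p y)

triangles-separate : ∀ (P P' : Fin 5) →
  P ≡ P' ⊎ Separates (triple (# 0) (# 1) (# 2)) P P'
         ⊎ Separates (triple (# 0) (# 1) (# 3)) P P'
         ⊎ Separates (triple (# 0) (# 2) (# 3)) P P'
triangles-separate = from-yes (all? {n = 5} λ P → all? {n = 5} λ P' →
  P ≟ P' ⊎-dec separates? (triple (# 0) (# 1) (# 2)) P P' ⊎-dec
  separates? (triple (# 0) (# 1) (# 3)) P P' ⊎-dec separates? (triple (# 0) (# 2) (# 3)) P P')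

+-squeeze : ∀ {a b c d} → a + b ≤ c + d → c ≤ a → d ≤ b → a ≡ c × b ≡ d
+-squeeze {a} {b} {c} {d} a+b≤c+d c≤a d≤b =
  ≤-antisym (+-cancelʳ-≤ b a c (≤-trans a+b≤c+d (+-monoʳ-≤ c d≤b))) c≤a ,
  ≤-antisym (+-cancelˡ-≤ a b d (≤-trans a+b≤c+d (+-monoˡ-≤ d c≤a))) d≤b

incidenceDistance : Bool → ℕ
incidenceDistance true = 1
incidenceDistance false = 3

incidenceDistance-injective : ∀ {b b'} → incidenceDistance b ≡ incidenceDistance b' → b ≡ b'
incidenceDistance-injective {false} {false} _ = refl
incidenceDistance-injective {true} {true} _ = refl

incidenceDistance-≢⇔ : ∀ {b b'} → incidenceDistance b ≢ incidenceDistance b' ⇔ b ≢ b'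
incidenceDistance-≢⇔ =
  mk⇔ (λ ι≢ι' → ι≢ι' ∘ cong incidenceDistance) (λ b≢b' → b≢b' ∘ incidenceDistance-injective)

module _ {n m : ℕ} (M : MobiusPlane n m) where

  private variable
    u v w s : Vertex M
    i j : ℕ
    P P' : Fin n
    z z' : Fin m

  Adj-sym : Adj M u v → Adj M v u
  Adj-sym (pz P∈z) = zp P∈z
  Adj-sym (zp P∈z) = pz P∈z

  Walk-snoc : Walk M u v i → Adj M v w → Walk M u w (suc i)
  Walk-snoc here e = step e here
  Walk-snoc (step e walk) e' = step e (Walk-snoc walk e')

  Walk-reverse : Walk M u v i → Walk M v u i
  Walk-reverse here = here
  Walk-reverse (step e walk) = Walk-snoc (Walk-reverse walk) (Adj-sym e)

  IsDist-sym : IsDist M u v i → IsDist M v u i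
  IsDist-sym (walk , shortest) = Walk-reverse walk , λ j j<i → shortest j j<i ∘ Walk-reverse

  IsDist-unique : IsDist M u v i → IsDist M u v j → i ≡ j
  IsDist-unique {i = i} {j = j} (walk , shortest) (walk' , shortest') with <-cmp i j
  ... | tri< i<j _ _ = contradiction walk (shortest' i i<j)
  ... | tri≈ _ i≡j _ = i≡j
  ... | tri> _ _ j<i = contradiction walk' (shortest j j<i)

  Distinguishes⇔ : IsDist M u s i → IsDist M v s j → Distinguishes M s u v ⇔ i ≢ j
  Distinguishes⇔ {i = i} {j = j} dᵤ dᵥ = mk⇔
    (λ (i' , j' , dᵤ' , dᵥ' , i'≢j') i≡j →
      i'≢j' (trans (IsDist-unique dᵤ' dᵤ) (trans i≡j (IsDist-unique dᵥ dᵥ'))))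
    (λ i≢j → i , j , dᵤ , dᵥ , i≢j)

  circle-nonempty : ∀ z → Nonempty (circle M z)
  circle-nonempty z = ∣p∣>0⇒Nonempty (circle M z) (≤-trans (s≤s z≤n) (circle-size M z))

  on-circle-dist : P ∈ circle M z → IsDist M (inj₂ z) (inj₁ P) 1
  on-circle-dist P∈z = step (zp P∈z) here , λ { zero _ () ; (suc j) (s≤s ()) _ }

  off-circle-dist : P ∉ circle M z → IsDist M (inj₂ z) (inj₁ P) 3
  off-circle-dist {P} {z} P∉z
    with Q , Q∈z ← circle-nonempty z
    with z' , Q∈z' , P∈z' , _ ← touch-exist M z Q P Q∈z P∉z =
    step (zp Q∈z) (step (pz Q∈z') (step (zp P∈z') here)) , shorter-impossible
    where
    shorter-impossible : ∀ j → j < 3 → ¬ Walk M (inj₂ z) (inj₁ P) j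
    shorter-impossible 1 _ (step (zp P∈z) here) = P∉z P∈z
    shorter-impossible 2 _ (step (zp _) (step (pz _) ()))
    shorter-impossible (suc (suc (suc j))) (s≤s (s≤s (s≤s ())))

  circle-point-dist : ∀ z P → IsDist M (inj₂ z) (inj₁ P) (incidenceDistance (lookup (circle M z) P))
  circle-point-dist z P with lookup (circle M z) P in eq
  ... | true = on-circle-dist (lookup⇒[]= P _ eq)
  ... | false = off-circle-dist (λ P∈z → contradiction (trans (sym ([]=⇒lookup P∈z)) eq) λ ())

  separates-circles⇔ : Distinguishes M (inj₁ P) (inj₂ z) (inj₂ z') ⇔
                       lookup (circle M z) P ≢ lookup (circle M z') P
  separates-circles⇔ {P} {z} {z'} =
    ⇔-trans (Distinguishes⇔ (circle-point-dist z P) (circle-point-dist z' P)) incidenceDistance-≢⇔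

  separates-points⇔ : Distinguishes M (inj₂ z) (inj₁ P) (inj₁ P') ⇔ Separates (circle M z) P P'
  separates-points⇔ {z} {P} {P'} =
    ⇔-trans (Distinguishes⇔ (IsDist-sym (circle-point-dist z P)) (IsDist-sym (circle-point-dist z P')))
            incidenceDistance-≢⇔

  CirclesSeparatedBy : Subset n → Set
  CirclesSeparatedBy SP =
    ∀ z z' → z ≢ z' → ∃ λ P → P ∈ SP × lookup (circle M z) P ≢ lookup (circle M z') P

  PointsSeparatedBy : Subset m → Set
  PointsSeparatedBy SZ = ∀ P P' → P ≢ P' → ∃ λ z → z ∈ SZ × Separates (circle M z) P P'

  splitResolving⇔ : ∀ {SP SZ} →
                    SplitResolving M SP SZ ⇔ (CirclesSeparatedBy SP × PointsSeparatedBy SZ)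
  splitResolving⇔ = mk⇔
    (Product.map (refine (Equivalence.to separates-circles⇔))
                 (refine (Equivalence.to separates-points⇔)))
    (Product.map (refine (Equivalence.from separates-circles⇔))
                 (refine (Equivalence.from separates-points⇔)))
    where
    refine : ∀ {X W : Set} {In : W → Set} {A B : X → X → W → Set} →
             (∀ {x y w} → A x y w → B x y w) →
             (∀ x y → x ≢ y → ∃ λ w → In w × A x y w) → ∀ x y → x ≢ y → ∃ λ w → In w × B x y w
    refine A⇒B separated x y x≢y = Product.map₂ (Product.map₂ A⇒B) (separated x y x≢y)

module _ {n m : ℕ} (M : MobiusPlane n m) (order-2 : HasOrder M 2) where

  ∈-circle⇒≢ : ∀ {z} → a ∈ circle M z → b ∉ circle M z → a ≢ b
  ∈-circle⇒≢ {z = z} a∈z b∉z refl = b∉z a∈z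

  circle-through : a ≢ b → a ≢ c → b ≢ c → ∃ λ z → circle M z ≡ triple a b c
  circle-through {a} {b} {c} a≢b a≢c b≢c
    with z , a∈z , b∈z , c∈z ← three-exist M a b c a≢b a≢c b≢c =
    z , ⊆-antisym (Equivalence.from ∈-triple⇔ ∘ only-a-b-c) (on-circle ∘ Equivalence.to ∈-triple⇔)
    where
    only-a-b-c : ∀ {x} → x ∈ circle M z → x ≡ a ⊎ x ≡ b ⊎ x ≡ c
    only-a-b-c = ∣p∣≤3⇒∈-triple (≤-reflexive (order-2 z)) a∈z b∈z c∈z a≢b a≢c b≢c
    on-circle : ∀ {x} → x ≡ a ⊎ x ≡ b ⊎ x ≡ c → x ∈ circle M z
    on-circle (inj₁ refl) = a∈z
    on-circle (inj₂ (inj₁ refl)) = b∈z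
    on-circle (inj₂ (inj₂ refl)) = c∈z

  touching-circles-cover : ∀ {z₀ z₁ A D} → A ∈ circle M z₀ → D ∉ circle M z₀ →
    A ∈ circle M z₁ → D ∈ circle M z₁ → (∀ R → R ∈ circle M z₀ → R ∈ circle M z₁ → R ≡ A) →
    ∀ F → F ∈ circle M z₀ ⊎ F ∈ circle M z₁
  touching-circles-cover {z₀} {z₁} {A} {D} A∈z₀ D∉z₀ A∈z₁ D∈z₁ z₀∩z₁⊆A F
    with F ∈? circle M z₀ | F ≟ D
  ... | yes F∈z₀ | _ = inj₁ F∈z₀
  ... | no _ | yes refl = inj₂ D∈z₁
  ... | no F∉z₀ | no F≢D
    with w , w≡ADF ← circle-through (∈-circle⇒≢ A∈z₀ D∉z₀) (∈-circle⇒≢ A∈z₀ F∉z₀) (≢-sym F≢D) =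
    inj₂ (subst (λ z → F ∈ circle M z) (sym z₁≡w) (on-w (inj₂ (inj₂ refl))))
    where
    on-w : ∀ {x} → x ≡ A ⊎ x ≡ D ⊎ x ≡ F → x ∈ circle M w
    on-w = subst (_ ∈_) (sym w≡ADF) ∘ Equivalence.from ∈-triple⇔
    z₀∩w⊆A : ∀ R → R ∈ circle M z₀ → R ∈ circle M w → R ≡ A
    z₀∩w⊆A R R∈z₀ R∈w with Equivalence.to ∈-triple⇔ (subst (R ∈_) w≡ADF R∈w)
    ... | inj₁ R≡A = R≡A
    ... | inj₂ (inj₁ refl) = contradiction R∈z₀ D∉z₀
    ... | inj₂ (inj₂ refl) = contradiction R∈z₀ F∉z₀
    z₁≡w : z₁ ≡ w
    z₁≡w = touch-unique M z₀ A D A∈z₀ D∉z₀ z₁ w A∈z₁ D∈z₁ z₀∩z₁⊆A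
      (on-w (inj₁ refl)) (on-w (inj₂ (inj₁ refl))) z₀∩w⊆A

  order-2⇒5-points : n ≡ 5
  order-2⇒5-points
    with z₀ ← some-circle M
    with A , A∈z₀ ← circle-nonempty M z₀
    with D , D∉z₀ ← circle-miss M z₀
    with z₁ , A∈z₁ , D∈z₁ , z₀∩z₁⊆A ← touch-exist M z₀ A D A∈z₀ D∉z₀ =
    ℕ.suc-injective (begin
      suc n                                       ≡⟨ cong₂ _+_ (∣⁅x⁆∣≡1 A) (∣⊤∣≡n n) ⟨
      ∣ ⁅ A ⁆ ∣ + ∣ ⊤ {n} ∣                        ≡⟨ cong₂ (λ p q → ∣ p ∣ + ∣ q ∣) z₀∩z₁≡A z₀∪z₁≡⊤ ⟨
      ∣ circle M z₀ ∩ circle M z₁ ∣ + ∣ circle M z₀ ∪ circle M z₁ ∣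
                                                  ≡⟨ ∣p∩q∣+∣p∪q∣≡∣p∣+∣q∣ (circle M z₀) (circle M z₁) ⟩
      ∣ circle M z₀ ∣ + ∣ circle M z₁ ∣             ≡⟨ cong₂ _+_ (order-2 z₀) (order-2 z₁) ⟩
      6                                           ∎)
    where
    open ≡-Reasoning
    z₀∩z₁≡A : circle M z₀ ∩ circle M z₁ ≡ ⁅ A ⁆
    z₀∩z₁≡A = ⊆-antisym
      (λ {x} x∈z₀∩z₁ → let (x∈z₀ , x∈z₁) = x∈p∩q⁻ _ _ x∈z₀∩z₁ in
        subst (_∈ ⁅ A ⁆) (sym (z₀∩z₁⊆A x x∈z₀ x∈z₁)) (x∈⁅x⁆ A))
      (λ {x} x∈A → subst (_∈ _) (sym (x∈⁅y⁆⇒x≡y A x∈A)) (x∈p∩q⁺ (A∈z₀ , A∈z₁)))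
    z₀∪z₁≡⊤ : circle M z₀ ∪ circle M z₁ ≡ ⊤ {n}
    z₀∪z₁≡⊤ = ⊆-antisym (λ _ → ∈⊤)
      (λ {x} _ → x∈p∪q⁺ (touching-circles-cover A∈z₀ D∉z₀ A∈z₁ D∈z₁ z₀∩z₁⊆A x))

  all-but-one-separate-circles : (x : Fin n) → CirclesSeparatedBy M (∁ ⁅ x ⁆)
  all-but-one-separate-circles x z z' z≢z'
    with any? (λ y → ¬? (y ≟ x) ×-dec ¬? (lookup (circle M z) y ≟ᵇ lookup (circle M z') y))
  ... | yes (y , y≢x , differ) = y , x∉p⇒x∈∁p (x≢y⇒x∉⁅y⁆ y≢x) , differ
  ... | no no-witness = contradiction (circle-inj M z z' same) z≢z'
    where
    same : circle M z ≡ circle M z'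
    same = agree-except⇒≡ _ _ x (trans (order-2 z) (sym (order-2 z'))) λ y y≢x →
      decidable-stable (_ ≟ᵇ _) (λ differ → no-witness (y , y≢x , differ))

module _ {m : ℕ} (M : MobiusPlane 5 m) (order-2 : HasOrder M 2) where

  private variable
    SP : Subset 5
    SZ : Subset m

  circles-separated⇒4≤∣SP∣ : CirclesSeparatedBy M SP → 4 ≤ ∣ SP ∣
  circles-separated⇒4≤∣SP∣ {SP} separated with 4 ≤? ∣ SP ∣
  ... | yes 4≤∣SP∣ = 4≤∣SP∣
  ... | no ∣SP∣<4
    with a , b , a≢b , a∉SP , b∉SP ← ∃₂-∉ SP (s≤s (≰⇒> ∣SP∣<4))
    with s , t , s≢t , s∉ab , t∉ab
           ← ∃₂-∉ (⁅ a ⁆ ∪ ⁅ b ⁆) (ℕ.m≤n⇒m≤1+n (+-monoʳ-≤ 2 (∣⁅a⁆∪⁅b⁆∣≤2 a b)))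
    with s≢a , s≢b ← ∉⁅a⁆∪⁅b⁆⇒≢ s∉ab
    with t≢a , t≢b ← ∉⁅a⁆∪⁅b⁆⇒≢ t∉ab
    with w₁ , w₁≡sta ← circle-through M order-2 s≢t s≢a t≢a
    with w₂ , w₂≡stb ← circle-through M order-2 s≢t s≢b t≢b
    with P , P∈SP , differ ← separated w₁ w₂ (λ w₁≡w₂ → triple-≢ (≢-sym s≢a) (≢-sym t≢a) a≢b
                                 (trans (sym w₁≡sta) (trans (cong (circle M) w₁≡w₂) w₂≡stb)))
    with P ≟ a | P ≟ b
  ... | yes refl | _ = contradiction P∈SP a∉SP
  ... | no _ | yes refl = contradiction P∈SP b∉SP
  ... | no P≢a | no P≢b = contradiction w₁-w₂-agree-at-P differ
    where
    open ≡-Reasoning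
    w₁-w₂-agree-at-P : lookup (circle M w₁) P ≡ lookup (circle M w₂) P
    w₁-w₂-agree-at-P = begin
      lookup (circle M w₁) P   ≡⟨ cong (λ p → lookup p P) w₁≡sta ⟩
      lookup (triple s t a) P  ≡⟨ lookup-triple-swap s t P P≢a P≢b ⟩
      lookup (triple s t b) P  ≡⟨ cong (λ p → lookup p P) w₂≡stb ⟨
      lookup (circle M w₂) P   ∎

  points-separated⇒3≤∣SZ∣ : PointsSeparatedBy M SZ → 3 ≤ ∣ SZ ∣
  points-separated⇒3≤∣SZ∣ {SZ} separated with 3 ≤? ∣ SZ ∣
  ... | yes 3≤∣SZ∣ = 3≤∣SZ∣
  ... | no ∣SZ∣<3
    with z₁ , z₂ , SZ⊆z₁z₂ ← ∣p∣≤2⇒∃-cover (some-circle M) SZ (ℕ.≤-pred (≰⇒> ∣SZ∣<3)) =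
    contradiction (separated-by-two⇒≤4 (circle M z₁) (circle M z₂) by-z₁-or-z₂) (ℕ.<-irrefl refl)
    where
    by-z₁-or-z₂ : ∀ P P' → P ≢ P' → Separates (circle M z₁) P P' ⊎ Separates (circle M z₂) P P'
    by-z₁-or-z₂ P P' P≢P' with z , z∈SZ , differ ← separated P P' P≢P' with SZ⊆z₁z₂ z∈SZ
    ... | inj₁ refl = inj₁ differ
    ... | inj₂ refl = inj₂ differ

  split-resolving-4+3 : ∃₂ λ SP SZ → SplitResolving M SP SZ × ∣ SP ∣ + ∣ SZ ∣ ≤ 4 + 3
  split-resolving-4+3
    with z₁ , z₁≡012 ← circle-through M order-2 {# 0} {# 1} {# 2} (λ ()) (λ ()) (λ ())
    with z₂ , z₂≡013 ← circle-through M order-2 {# 0} {# 1} {# 3} (λ ()) (λ ()) (λ ())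
    with z₃ , z₃≡023 ← circle-through M order-2 {# 0} {# 2} {# 3} (λ ()) (λ ()) (λ ()) =
    ∁ ⁅ # 0 ⁆ , triple z₁ z₂ z₃ ,
    Equivalence.from (splitResolving⇔ M)
      (all-but-one-separate-circles M order-2 (# 0) , by-triangles) ,
    +-monoʳ-≤ 4 (∣triple∣≤3 z₁ z₂ z₃)
    where
    via : ∀ {z p P P'} → circle M z ≡ p → Separates p P P' → Separates (circle M z) P P'
    via {P = P} {P'} z≡p = subst (λ p → Separates p P P') (sym z≡p)
    by-triangles : PointsSeparatedBy M (triple z₁ z₂ z₃)
    by-triangles P P' P≢P' with triangles-separate P P'
    ... | inj₁ P≡P' = contradiction P≡P' P≢P'
    ... | inj₂ (inj₁ sep) = z₁ , Equivalence.from ∈-triple⇔ (inj₁ refl) , via z₁≡012 sep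
    ... | inj₂ (inj₂ (inj₁ sep)) = z₂ , Equivalence.from ∈-triple⇔ (inj₂ (inj₁ refl)) , via z₂≡013 sep
    ... | inj₂ (inj₂ (inj₂ sep)) = z₃ , Equivalence.from ∈-triple⇔ (inj₂ (inj₂ refl)) , via z₃≡023 sep

mainTheorem11 : ∀ {n m : ℕ} (M : MobiusPlane n m) → HasOrder M 2 →
    (SP : Subset n) (SZ : Subset m) → MinSplitResolving M SP SZ →
    ∣ SP ∣ ≡ 4 × ∣ SZ ∣ ≡ 3
mainTheorem11 M order-2 SP SZ (resolving , minimal) with order-2⇒5-points M order-2
... | refl =
  -- let rather than with: abstracting the goal over this witness is prohibitively expensive.
  let (SP' , SZ' , resolving' , small) = split-resolving-4+3 M order-2
      (circles , points) = Equivalence.to (splitResolving⇔ M) resolving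
  in +-squeeze (≤-trans (minimal SP' SZ' resolving') small)
       (circles-separated⇒4≤∣SP∣ M order-2 circles) (points-separated⇒3≤∣SZ∣ M order-2 points)
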